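{- For $n\ge 1$, $$|\mathrm{Modasc}_n(321)|=\sum_{j=0}^{n-1}\binom{n-1}{j}c_{j},$$ where $c_j=\frac{1}{j+1}\binom{2j}{j}$ is the $j$th Catalan number.
   Context: A Cayley permutation of length $n$ is a word $x=x_1\cdots x_n$ of positive integers whose set of values is $\{1,\dots,k\}$ for some $k\le n$. $x$ contains $y=y_1\cdots y_k$ if there are indices $i_1<\cdots<i_k$ with $x_{i_s}<x_{i_t}\iff y_s<y_t$ and $x_{i_s}=x_{i_t}\iff y_s=y_t$ for all $s,t$; otherwise $x$ avoids $y$. The ascent tops of $x$ are the pairs $(1,x_1)$ and $(i,x_i)$ with $1<i\le n$ and $x_{i-1}<x_i$; the leftmost copies are the pairs $(\min\{i:x_i=j\},j)$ for $1\le j\le\max(x)$. A modified ascent sequence is a Cayley permutation whose set of ascent tops equals its set of leftmost copies. $\mathrm{Modasc}_n(y)$ is the set of modified ascent sequences of length $n$ avoiding $y$. -}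

module Defs where

open import Data.Nat using (ℕ; zero; suc; _+_; _*_; _≤_; _<_; _⊔_; _/_)
open import Data.Nat.Combinatorics using (_C_)
open import Data.Fin using (Fin; toℕ)
open import Data.Vec using (Vec; lookup; toList; []; _∷_)
open import Data.List using (List; length; foldr; map; upTo)
open import Data.Nat.ListAction using (sum)
open import Data.List.Relation.Unary.Unique.Propositional using (Unique)
open import Data.List.Membership.Propositional using (_∈_)
open import Data.Product using (Σ; ∃; _×_)
open import Data.Sum using (_⊎_)
open import Function.Bundles using (_⇔_)
open import Relation.Nullary using (¬_)
open import Relation.Binary.PropositionalEquality using (_≡_; _≢_)

maxV : ∀ {n} → Vec ℕ n → ℕ
maxV x = foldr _⊔_ 0 (toList x)

IsCayley : ∀ {n} → Vec ℕ n → Set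
IsCayley {n} x = ∃ λ k → k ≤ n ×
  (∀ v → (∃ λ (i : Fin n) → lookup x i ≡ v) ⇔ (1 ≤ v × v ≤ k))

Contains : ∀ {n k} → Vec ℕ n → Vec ℕ k → Set
Contains {n} {k} x y = Σ (Fin k → Fin n) λ f →
  (∀ s t → toℕ s < toℕ t → toℕ (f s) < toℕ (f t)) ×
  (∀ s t → ((lookup x (f s) < lookup x (f t)) ⇔ (lookup y s < lookup y t))
         × ((lookup x (f s) ≡ lookup x (f t)) ⇔ (lookup y s ≡ lookup y t)))

Avoids : ∀ {n k} → Vec ℕ n → Vec ℕ k → Set
Avoids x y = ¬ Contains x y

AscentTop : ∀ {n} → Vec ℕ n → Fin n → ℕ → Set
AscentTop {n} x i v = v ≡ lookup x i ×
  (toℕ i ≡ 0 ⊎ (∃ λ (j : Fin n) → suc (toℕ j) ≡ toℕ i × lookup x j < lookup x i))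

LeftmostCopy : ∀ {n} → Vec ℕ n → Fin n → ℕ → Set
LeftmostCopy {n} x i v = 1 ≤ v × v ≤ maxV x × lookup x i ≡ v ×
  (∀ (j : Fin n) → toℕ j < toℕ i → lookup x j ≢ v)

IsModAsc : ∀ {n} → Vec ℕ n → Set
IsModAsc {n} x = IsCayley x × (∀ (i : Fin n) (v : ℕ) → AscentTop x i v ⇔ LeftmostCopy x i v)

p321 : Vec ℕ 3
p321 = 3 ∷ 2 ∷ 1 ∷ []

HasSize : ∀ {n} → (Vec ℕ n → Set) → ℕ → Set
HasSize {n} P N = Σ (List (Vec ℕ n)) λ L →
  Unique L × (∀ x → (x ∈ L) ⇔ P x) × length L ≡ N

catalan : ℕ → ℕ
catalan j = ((2 * j) C j) / suc j

catSum : ℕ → ℕ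
catSum n = sum (map (λ j → ((n Data.Nat.∸ 1) C j) * catalan j) (upTo n))

-- Words are grown by appending letters on the right. A 321-avoiding modified ascent sequence x
-- extends by a letter c exactly when t ≤ c ≤ max x + 1, where t is 1 or the largest letter of x
-- lying below an earlier letter: a letter not exceeding the last one must repeat a value, while a
-- larger one is an ascent top, hence a new value, inserted by moving the letters ≥ c up by one.
-- Labelling x by h = max x − t, the children of a node labelled h are labelled h, 1, 2, …, h + 1,
-- so the words of length n + 1 are counted by ((I + S)ⁿ 1)(0), where S F h = F 1 + ⋯ + F (h + 1).
-- By the binomial theorem this is Σᵢ C(n, i) (Sⁱ 1)(0), and (Sⁱ 1)(h) is the ballot number
-- C(2i + h, i) − C(2i + h, i − 1), which is cᵢ at h = 0.

module Submission where

open import Defs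
open import Data.Nat using (ℕ; _≤_)
open import Data.Product using (_×_)

open import Data.Fin using (Fin; zero; suc; toℕ; fromℕ; inject₁; lower₁)
open import Data.Fin.Properties using (toℕ-inject₁; toℕ-fromℕ; toℕ<n; toℕ-injective; inject₁-lower₁)
open import Data.Fin.Relation.Unary.Top using (view; ‵fromℕ; ‵inj₁)
open import Data.List using (List; []; _∷_; _++_; applyUpTo; concatMap; length)
import Data.List as List
open import Data.List.Properties using (map-++; map-cong-local; length-map)
open import Data.List.Membership.Propositional using () renaming (_∈_ to _∈ₗ_; find to findₗ)
open import Data.List.Membership.Propositional.Properties
  using (∈-applyUpTo⁺; ∈-applyUpTo⁻; ∈-concatMap⁺; ∈-concatMap⁻)
import Data.List.Membership.Propositional.Properties as List∈
import Data.List.Relation.Unary.Any as Anyₗ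
import Data.List.Relation.Unary.All as All
import Data.List.Relation.Unary.All.Properties as All
open import Data.List.Relation.Unary.AllPairs using ([]; _∷_)
import Data.List.Relation.Unary.AllPairs as AllPairs
import Data.List.Relation.Unary.AllPairs.Properties as AllPairs
open import Data.List.Relation.Unary.Unique.Propositional using (Unique)
open import Data.List.Relation.Unary.Unique.Propositional.Properties using (concat⁺; applyUpTo⁺₁; map⁺)
open import Data.List.Relation.Binary.Disjoint.Propositional using (Disjoint)
open import Data.Nat using (zero; suc; pred; _+_; _*_; _∸_; _<_; _≮_; _⊔_; s≤s; z≤n; _≟_; _≤?_; _<?_)
open import Data.Nat.Combinatorics using (_C_; nCk≡nC[n∸k]; nCk+nC[k+1]≡[n+1]C[k+1]; k>n⇒nCk≡0; nC1≡n)
open import Data.Nat.DivMod using (m*n/n≡m; _/_)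
open import Data.Nat.ListAction using (sum)
open import Data.Nat.ListAction.Properties using (sum-++)
open import Data.Nat.Properties
open import Algebra.Properties.CommutativeSemigroup +-commutativeSemigroup
  using (interchange; x∙yz≈xz∙y; xy∙z≈y∙xz)
open import Data.Nat.Tactic.RingSolver using (solve-∀)
open import Data.Product using (∃; _,_; proj₁; proj₂; uncurry)
open import Data.Sum using (_⊎_; inj₁; inj₂; [_,_]′)
open import Data.Unit using (⊤; tt)
open import Data.Vec using (Vec; []; _∷_; _∷ʳ_; map; head; lookup; reverse)
open import Data.Vec.Properties using (reverse-∷; reverse-injective; reverse-involutive)
open import Data.Vec.Membership.Propositional using (_∈_; _∉_; find)
open import Data.Vec.Membership.Propositional.Properties using (∈-map⁺; ∈-lookup)
open import Data.Vec.Membership.DecPropositional _≟_ using (_∈?_)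
open import Data.Vec.Relation.Unary.Any using (here; there; index)
import Data.Vec.Relation.Unary.Any.Properties as Any
open import Data.Vec.Relation.Unary.Any.Properties using (lookup-index)
open import Function using (id; _∘_; _⇔_; mk⇔; Equivalence)
import Function.Properties.Equivalence as ⇔
open import Relation.Binary.Definitions using (tri<; tri≈; tri>)
open import Relation.Binary.PropositionalEquality
open import Relation.Nullary using (¬_; Dec; yes; no; contradiction)
open import Relation.Nullary.Decidable using (dec-yes-irr; dec-no)

open Equivalence using (to; from)

-- Finite sums and the binomial transform

∑< : ℕ → (ℕ → ℕ) → ℕ
∑< zero    f = 0
∑< (suc m) f = ∑< m f + f m

syntax ∑< m (λ i → e) = ∑[ i < m ] e

∑<-cong : ∀ m {f g} → (∀ i → i < m → f i ≡ g i) → ∑< m f ≡ ∑< m g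
∑<-cong zero    eq = refl
∑<-cong (suc m) eq = cong₂ _+_ (∑<-cong m (λ i i<m → eq i (m<n⇒m<1+n i<m))) (eq m (n<1+n m))

∑<-+ : ∀ m f g → ∑[ i < m ] (f i + g i) ≡ ∑< m f + ∑< m g
∑<-+ zero    f g = refl
∑<-+ (suc m) f g = begin
  ∑[ i < m ] (f i + g i) + (f m + g m) ≡⟨ cong (_+ (f m + g m)) (∑<-+ m f g) ⟩
  ∑< m f + ∑< m g + (f m + g m)        ≡⟨ interchange (∑< m f) (∑< m g) (f m) (g m) ⟩
  ∑< m f + f m + (∑< m g + g m)        ∎
  where open ≡-Reasoning

∑<-suc : ∀ m f → ∑< (suc m) f ≡ f 0 + ∑[ i < m ] f (suc i)
∑<-suc zero    f = +-comm 0 (f 0)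
∑<-suc (suc m) f = begin
  ∑< (suc m) f + f (suc m)                 ≡⟨ cong (_+ f (suc m)) (∑<-suc m f) ⟩
  f 0 + ∑[ i < m ] f (suc i) + f (suc m)   ≡⟨ +-assoc (f 0) _ _ ⟩
  f 0 + ∑[ i < suc m ] f (suc i)           ∎
  where open ≡-Reasoning

∑<-reverse : ∀ m (f : ℕ → ℕ) → ∑[ k < m ] f (m ∸ k) ≡ ∑[ k < m ] f (suc k)
∑<-reverse zero    f = refl
∑<-reverse (suc m) f = begin
  ∑[ k < suc m ] f (suc m ∸ k)       ≡⟨ ∑<-suc m (λ k → f (suc m ∸ k)) ⟩
  f (suc m) + ∑[ k < m ] f (m ∸ k)   ≡⟨ cong (f (suc m) +_) (∑<-reverse m f) ⟩
  f (suc m) + ∑[ k < m ] f (suc k)   ≡⟨ +-comm (f (suc m)) _ ⟩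
  ∑[ k < suc m ] f (suc k)           ∎
  where open ≡-Reasoning

sum-map-applyUpTo : ∀ {A : Set} (f : A → ℕ) (g : ℕ → A) m →
                    sum (List.map f (applyUpTo g m)) ≡ ∑[ i < m ] f (g i)
sum-map-applyUpTo f g zero    = refl
sum-map-applyUpTo f g (suc m) = begin
  f (g 0) + sum (List.map f (applyUpTo (g ∘ suc) m)) ≡⟨ cong (f (g 0) +_) (sum-map-applyUpTo f (g ∘ suc) m) ⟩
  f (g 0) + ∑[ i < m ] f (g (suc i))                 ≡⟨ ∑<-suc m (λ i → f (g i)) ⟨
  ∑[ i < suc m ] f (g i)                             ∎
  where open ≡-Reasoning

sum-map-concatMap : ∀ {A B : Set} (g : B → ℕ) (f : A → List B) xs →
  sum (List.map g (concatMap f xs)) ≡ sum (List.map (λ x → sum (List.map g (f x))) xs)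
sum-map-concatMap g f []       = refl
sum-map-concatMap g f (x ∷ xs) = begin
  sum (List.map g (f x ++ concatMap f xs))
    ≡⟨ cong sum (map-++ g (f x) (concatMap f xs)) ⟩
  sum (List.map g (f x) ++ List.map g (concatMap f xs))
    ≡⟨ sum-++ (List.map g (f x)) _ ⟩
  sum (List.map g (f x)) + sum (List.map g (concatMap f xs))
    ≡⟨ cong (sum (List.map g (f x)) +_) (sum-map-concatMap g f xs) ⟩
  sum (List.map g (f x)) + sum (List.map (λ x → sum (List.map g (f x))) xs) ∎
  where open ≡-Reasoning

length≡sum-map-1 : ∀ {A : Set} (xs : List A) → length xs ≡ sum (List.map (λ _ → 1) xs)
length≡sum-map-1 []       = refl
length≡sum-map-1 (x ∷ xs) = cong suc (length≡sum-map-1 xs)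

binomialTransform : ℕ → (ℕ → ℕ) → ℕ
binomialTransform n g = ∑[ i < suc n ] ((n C i) * g i)

binomialTransform-cong : ∀ n {f g} → f ≗ g → binomialTransform n f ≡ binomialTransform n g
binomialTransform-cong n eq = ∑<-cong (suc n) (λ i _ → cong ((n C i) *_) (eq i))

binomialTransform-+ : ∀ n f g →
  binomialTransform n (λ i → f i + g i) ≡ binomialTransform n f + binomialTransform n g
binomialTransform-+ n f g = trans (∑<-cong (suc n) (λ i _ → *-distribˡ-+ (n C i) (f i) (g i)))
                                  (∑<-+ (suc n) (λ i → (n C i) * f i) (λ i → (n C i) * g i))

binomialTransform-suc : ∀ n g →
  binomialTransform (suc n) g ≡ binomialTransform n g + binomialTransform n (g ∘ suc)
binomialTransform-suc n g = begin
  binomialTransform (suc n) g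
    ≡⟨ ∑<-suc (suc n) (λ i → (suc n C i) * g i) ⟩
  1 * g 0 + ∑[ i < suc n ] ((suc n C suc i) * g (suc i))
    ≡⟨ cong (1 * g 0 +_) (∑<-cong (suc n) (λ i _ → pascal i)) ⟩
  1 * g 0 + ∑[ i < suc n ] ((n C i) * g (suc i) + (n C suc i) * g (suc i))
    ≡⟨ cong (1 * g 0 +_) (∑<-+ (suc n) _ _) ⟩
  1 * g 0 + (binomialTransform n (g ∘ suc) + X)
    ≡⟨ x∙yz≈xz∙y (1 * g 0) (binomialTransform n (g ∘ suc)) X ⟩
  1 * g 0 + X + binomialTransform n (g ∘ suc)
    ≡⟨ cong (_+ binomialTransform n (g ∘ suc)) (∑<-suc (suc n) (λ i → (n C i) * g i)) ⟨
  ∑[ i < suc (suc n) ] ((n C i) * g i) + binomialTransform n (g ∘ suc)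
    ≡⟨ cong (λ c → binomialTransform n g + c * g (suc n) + binomialTransform n (g ∘ suc))
            (k>n⇒nCk≡0 (n<1+n n)) ⟩
  binomialTransform n g + 0 + binomialTransform n (g ∘ suc)
    ≡⟨ cong (_+ binomialTransform n (g ∘ suc)) (+-identityʳ (binomialTransform n g)) ⟩
  binomialTransform n g + binomialTransform n (g ∘ suc) ∎
  where
  open ≡-Reasoning
  X = ∑[ i < suc n ] ((n C suc i) * g (suc i))
  pascal : ∀ i → (suc n C suc i) * g (suc i) ≡ (n C i) * g (suc i) + (n C suc i) * g (suc i)
  pascal i = trans (cong (_* g (suc i)) (sym (nCk+nC[k+1]≡[n+1]C[k+1] n i)))
                   (*-distribʳ-+ (g (suc i)) (n C i) (n C suc i))

-- The succession rule, ballot numbers and Catalan numbers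

iterate : {A : Set} → (A → A) → ℕ → A → A
iterate f zero    = id
iterate f (suc n) = iterate f n ∘ f

iterate-suc : ∀ {A : Set} (f : A → A) n x → iterate f (suc n) x ≡ f (iterate f n x)
iterate-suc f zero    x = refl
iterate-suc f (suc n) x = iterate-suc f n (f x)

module _ (T : (ℕ → ℕ) → ℕ → ℕ)
         (T-cong : ∀ {F G} → F ≗ G → T F ≗ T G)
         (T-+ : ∀ F G → T (λ x → F x + G x) ≗ λ x → T F x + T G x) where

  iterate-cong : ∀ i {F G} → F ≗ G → iterate T i F ≗ iterate T i G
  iterate-cong zero    eq = eq
  iterate-cong (suc i) eq = iterate-cong i (T-cong eq)

  iterate-+ : ∀ i F G → iterate T i (λ x → F x + G x) ≗ λ x → iterate T i F x + iterate T i G x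
  iterate-+ zero    F G h = refl
  iterate-+ (suc i) F G h = trans (iterate-cong i (T-+ F G) h) (iterate-+ i (T F) (T G) h)

  iterate-id+T : ∀ n F h →
    iterate (λ F x → F x + T F x) n F h ≡ binomialTransform n (λ i → iterate T i F h)
  iterate-id+T zero    F h = sym (+-identityʳ (F h))
  iterate-id+T (suc n) F h = begin
    iterate (λ F x → F x + T F x) n (λ x → F x + T F x) h
      ≡⟨ iterate-id+T n (λ x → F x + T F x) h ⟩
    binomialTransform n (λ i → iterate T i (λ x → F x + T F x) h)
      ≡⟨ binomialTransform-cong n (λ i → iterate-+ i F (T F) h) ⟩
    binomialTransform n (λ i → iterate T i F h + iterate T (suc i) F h)
      ≡⟨ binomialTransform-+ n _ _ ⟩
    binomialTransform n (λ i → iterate T i F h) + binomialTransform n (λ i → iterate T (suc i) F h)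
      ≡⟨ binomialTransform-suc n (λ i → iterate T i F h) ⟨
    binomialTransform (suc n) (λ i → iterate T i F h) ∎
    where open ≡-Reasoning

Σ⁺ : (ℕ → ℕ) → ℕ → ℕ
Σ⁺ F h = ∑[ l < suc h ] F (suc l)

-- The generating tree below obeys the succession rule (h) ↝ (h) (1) (2) ⋯ (h + 1): summing F over
-- the labels of the nodes n levels below a node labelled h gives iterate succession n F h.
succession : (ℕ → ℕ) → ℕ → ℕ
succession F h = F h + Σ⁺ F h

iterate-succession : ∀ n F h →
  iterate succession n F h ≡ binomialTransform n (λ i → iterate Σ⁺ i F h)
iterate-succession = iterate-id+T Σ⁺ (λ eq h → ∑<-cong (suc h) (λ l _ → eq (suc l)))
                                     (λ F G h → ∑<-+ (suc h) (F ∘ suc) (G ∘ suc))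

ballot : ℕ → ℕ → ℕ
ballot i = iterate Σ⁺ i (λ _ → 1)

ballot-suc : ∀ i h → ballot (suc i) h ≡ Σ⁺ (ballot i) h
ballot-suc i = cong-app (iterate-suc Σ⁺ i (λ _ → 1))

_C⁻_ : ℕ → ℕ → ℕ
n C⁻ zero  = 0
n C⁻ suc i = n C i

suc-C : ∀ n i → suc n C i ≡ n C⁻ i + n C i
suc-C n zero    = refl
suc-C n (suc i) = sym (nCk+nC[k+1]≡[n+1]C[k+1] n i)

C-sym : ∀ m k → (m + k) C m ≡ (m + k) C k
C-sym m k = trans (nCk≡nC[n∸k] (m≤m+n m k)) (cong ((m + k) C_) (m+n∸m≡n m k))

ballot+C⁻≡C : ∀ i h {t} → t ≡ i + i + h → ballot i h + t C⁻ i ≡ t C i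
ballot+C⁻≡C zero    h refl = refl
ballot+C⁻≡C (suc i) zero {t} t≡ = begin
  ballot (suc i) 0 + t C⁻ suc i      ≡⟨ cong₂ _+_ (ballot-suc i 0) (cong (_C i) t≡1+M) ⟩
  ballot i 1 + suc M C i             ≡⟨ cong (ballot i 1 +_) (suc-C M i) ⟩
  ballot i 1 + (M C⁻ i + M C i)      ≡⟨ +-assoc (ballot i 1) _ _ ⟨
  ballot i 1 + M C⁻ i + M C i        ≡⟨ cong (_+ M C i) (ballot+C⁻≡C i 1 (trans (+-suc i i) (+-comm 1 (i + i)))) ⟩
  M C i + M C i                      ≡⟨ cong (M C i +_) (C-sym i (suc i)) ⟩
  M C i + M C suc i                  ≡⟨ nCk+nC[k+1]≡[n+1]C[k+1] M i ⟩
  suc M C suc i                      ≡⟨ cong (_C suc i) t≡1+M ⟨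
  t C suc i                          ∎
  where
  open ≡-Reasoning
  M = i + suc i
  t≡1+M : t ≡ suc M
  t≡1+M = trans t≡ (cong suc (+-identityʳ M))
ballot+C⁻≡C (suc i) (suc h) {t} t≡ = begin
  ballot (suc i) (suc h) + t C⁻ suc i
    ≡⟨ cong (ballot (suc i) (suc h) +_) (cong (_C i) t≡1+M) ⟩
  ballot (suc i) (suc h) + suc M C i
    ≡⟨ cong₂ _+_ (ballot-suc i (suc h)) (suc-C M i) ⟩
  Σ⁺ (ballot i) h + ballot i (2 + h) + (M C⁻ i + M C i)
    ≡⟨ cong (λ b → b + ballot i (2 + h) + (M C⁻ i + M C i)) (ballot-suc i h) ⟨
  ballot (suc i) h + ballot i (2 + h) + (M C⁻ i + M C i)
    ≡⟨ cong (_+ (M C⁻ i + M C i)) (+-comm (ballot (suc i) h) (ballot i (2 + h))) ⟩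
  ballot i (2 + h) + ballot (suc i) h + (M C⁻ i + M C i)
    ≡⟨ interchange (ballot i (2 + h)) (ballot (suc i) h) (M C⁻ i) (M C i) ⟩
  (ballot i (2 + h) + M C⁻ i) + (ballot (suc i) h + M C i)
    ≡⟨ cong₂ _+_ (ballot+C⁻≡C i (2 + h) refl) (ballot+C⁻≡C (suc i) h (regroup′ i h)) ⟩
  M C i + M C suc i
    ≡⟨ nCk+nC[k+1]≡[n+1]C[k+1] M i ⟩
  suc M C suc i
    ≡⟨ cong (_C suc i) t≡1+M ⟨
  t C suc i ∎
  where
  open ≡-Reasoning
  M = i + i + (2 + h)
  regroup : ∀ i h → i + suc i + suc h ≡ i + i + (2 + h)
  regroup = solve-∀
  t≡1+M : t ≡ suc M
  t≡1+M = trans t≡ (cong suc (regroup i h))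
  regroup′ : ∀ i h → i + i + (2 + h) ≡ suc i + suc i + h
  regroup′ = solve-∀

C-absorb : ∀ n k → suc k * (suc n C suc k) ≡ suc n * (n C k)
C-absorb zero    zero    = refl
C-absorb zero    (suc k) = *-zeroʳ (suc (suc k))
C-absorb (suc n) zero    = trans (+-identityʳ _) (trans (nC1≡n (suc (suc n))) (sym (*-identityʳ (suc (suc n)))))
C-absorb (suc n) (suc k) = begin
  suc (suc k) * (suc (suc n) C suc (suc k))
    ≡⟨ cong (suc (suc k) *_) (nCk+nC[k+1]≡[n+1]C[k+1] (suc n) (suc k)) ⟨
  suc (suc k) * (suc n C suc k + suc n C suc (suc k))
    ≡⟨ *-distribˡ-+ (suc (suc k)) (suc n C suc k) (suc n C suc (suc k)) ⟩
  suc n C suc k + suc k * (suc n C suc k) + suc (suc k) * (suc n C suc (suc k))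
    ≡⟨ cong₂ (λ a b → suc n C suc k + a + b) (C-absorb n k) (C-absorb n (suc k)) ⟩
  suc n C suc k + suc n * (n C k) + suc n * (n C suc k)
    ≡⟨ +-assoc (suc n C suc k) _ _ ⟩
  suc n C suc k + (suc n * (n C k) + suc n * (n C suc k))
    ≡⟨ cong (suc n C suc k +_) (*-distribˡ-+ (suc n) (n C k) (n C suc k)) ⟨
  suc n C suc k + suc n * (n C k + n C suc k)
    ≡⟨ cong (λ c → suc n C suc k + suc n * c) (nCk+nC[k+1]≡[n+1]C[k+1] n k) ⟩
  suc (suc n) * (suc n C suc k) ∎
  where open ≡-Reasoning

-- At h = 0 the ballot identity reads ballot j 0 = C(2j, j) − C(2j, j − 1), and
-- (j + 1) C(2j, j − 1) = j C(2j, j) turns this into (j + 1) ballot j 0 = C(2j, j).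
suc-*-ballot : ∀ j → suc j * ballot j 0 ≡ (2 * j) C j
suc-*-ballot zero    = refl
suc-*-ballot (suc k) = +-cancelʳ-≡ (suc j * X) (suc j * ballot j 0) Cⱼ (begin
  suc j * ballot j 0 + suc j * X  ≡⟨ *-distribˡ-+ (suc j) (ballot j 0) X ⟨
  suc j * (ballot j 0 + X)        ≡⟨ cong (suc j *_) (ballot+C⁻≡C j 0 (2j≡j+j+0 k)) ⟩
  suc j * Cⱼ                      ≡⟨ cong (Cⱼ +_) j*Cⱼ≡suc-j*X ⟩
  Cⱼ + suc j * X                  ∎)
  where
  open ≡-Reasoning
  2j≡j+j+0 : ∀ k → 2 * suc k ≡ suc k + suc k + 0
  2j≡j+j+0 = solve-∀
  2j≡1+n : ∀ k → 2 * suc k ≡ suc (k + suc k)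
  2j≡1+n = solve-∀
  2j≡2+k+k : ∀ k → 2 * suc k ≡ suc (suc k) + k
  2j≡2+k+k = solve-∀
  j = suc k
  n = k + suc k
  X = (2 * j) C k
  Cⱼ = (2 * j) C j
  j*Cⱼ≡suc-j*X : j * Cⱼ ≡ suc j * X
  j*Cⱼ≡suc-j*X = begin
    j * ((2 * j) C j)             ≡⟨ cong (λ m → j * (m C j)) (2j≡1+n k) ⟩
    j * (suc n C j)               ≡⟨ C-absorb n k ⟩
    suc n * (n C k)               ≡⟨ cong (suc n *_) (C-sym k (suc k)) ⟩
    suc n * (n C suc k)           ≡⟨ C-absorb n (suc k) ⟨
    suc j * (suc n C suc j)       ≡⟨ cong (λ m → suc j * (m C suc j)) (trans (sym (2j≡1+n k)) (2j≡2+k+k k)) ⟩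
    suc j * ((suc j + k) C suc j) ≡⟨ cong (suc j *_) (C-sym (suc j) k) ⟩
    suc j * ((suc j + k) C k)     ≡⟨ cong (λ m → suc j * (m C k)) (2j≡2+k+k k) ⟨
    suc j * X                     ∎

catalan≡ballot : ∀ j → catalan j ≡ ballot j 0
catalan≡ballot j = begin
  ((2 * j) C j) / suc j          ≡⟨ cong (_/ suc j) (trans (*-comm (ballot j 0) (suc j)) (suc-*-ballot j)) ⟨
  (ballot j 0 * suc j) / suc j   ≡⟨ m*n/n≡m (ballot j 0) (suc j) ⟩
  ballot j 0                     ∎
  where open ≡-Reasoning

iterate-succession≡catSum : ∀ d → iterate succession d (λ _ → 1) 0 ≡ catSum (suc d)
iterate-succession≡catSum d = begin
  iterate succession d (λ _ → 1) 0      ≡⟨ iterate-succession d (λ _ → 1) 0 ⟩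
  binomialTransform d (λ i → ballot i 0) ≡⟨ binomialTransform-cong d (λ i → sym (catalan≡ballot i)) ⟩
  ∑[ i < suc d ] ((d C i) * catalan i)   ≡⟨ sum-map-applyUpTo (λ i → (d C i) * catalan i) id (suc d) ⟨
  catSum (suc d)                         ∎
  where open ≡-Reasoning

-- Reversed words and their generating tree

-- A word is stored reversed: the head of the vector is its last letter.

Ascends : ∀ {n} → ℕ → Vec ℕ n → Set
Ascends a []      = ⊤
Ascends a (b ∷ w) = b < a

thresholdStep : ℕ → ℕ → ℕ → ℕ
thresholdStep a m t with a <? m
... | yes _ = a ⊔ t
... | no  _ = t

-- threshold w is 1 ⊔ the largest letter of w lying below an earlier letter: appending
-- a letter creates a 321 exactly when the letter is smaller than this.
threshold : ∀ {n} → Vec ℕ n → ℕ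
threshold []      = 1
threshold (a ∷ w) = thresholdStep a (maxV w) (threshold w)

ModAscʳ : ∀ {n} → Vec ℕ n → Set
ModAscʳ []      = ⊤
ModAscʳ (a ∷ w) = ModAscʳ w × (Ascends a w ⇔ a ∉ w)

Avoid321ʳ : ∀ {n} → Vec ℕ n → Set
Avoid321ʳ []      = ⊤
Avoid321ʳ (a ∷ w) = Avoid321ʳ w × threshold w ≤ a

Gapless : ∀ {n} → Vec ℕ n → Set
Gapless w = ∀ {v} → 1 ≤ v → v ≤ maxV w → v ∈ w

record Modasc321ʳ {n} (w : Vec ℕ n) : Set where
  constructor mkModasc321ʳ
  field
    modAsc   : ModAscʳ w
    avoids   : Avoid321ʳ w
    positive : ∀ {v} → v ∈ w → 1 ≤ v
    gapless  : Gapless w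

open Modasc321ʳ

label : ∀ {n} → Vec ℕ n → ℕ
label w = maxV w ∸ threshold w

∈⇒≤maxV : ∀ {n v} {w : Vec ℕ n} → v ∈ w → v ≤ maxV w
∈⇒≤maxV {w = a ∷ w} (here refl) = m≤m⊔n a (maxV w)
∈⇒≤maxV {w = a ∷ w} (there v∈w) = ≤-trans (∈⇒≤maxV v∈w) (m≤n⊔m a (maxV w))

maxV-lub : ∀ {n k} (w : Vec ℕ n) → (∀ {v} → v ∈ w → v ≤ k) → maxV w ≤ k
maxV-lub []      bound = z≤n
maxV-lub (a ∷ w) bound = ⊔-lub (bound (here refl)) (maxV-lub w (bound ∘ there))

<maxV⇒∃ : ∀ {n b} (w : Vec ℕ n) → b < maxV w → ∃ λ v → v ∈ w × b < v
<maxV⇒∃ {b = b} (a ∷ w) b<max with ⊔-sel a (maxV w)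
... | inj₁ eq = a , here refl , subst (b <_) eq b<max
... | inj₂ eq with <maxV⇒∃ w (subst (b <_) eq b<max)
...   | v , v∈w , b<v = v , there v∈w , b<v

thresholdStep-< : ∀ {a m} t → a < m → thresholdStep a m t ≡ a ⊔ t
thresholdStep-< {a} {m} t a<m with a <? m
... | yes _   = refl
... | no  a≮m = contradiction a<m a≮m

thresholdStep-≮ : ∀ {a m} t → a ≮ m → thresholdStep a m t ≡ t
thresholdStep-≮ {a} {m} t a≮m with a <? m
... | yes a<m = contradiction a<m a≮m
... | no  _   = refl

thresholdStep-≤ : ∀ a m {t} → t ≤ a → thresholdStep a m t ≤ a
thresholdStep-≤ a m t≤a with a <? m
... | yes _ = ⊔-lub ≤-refl t≤a
... | no  _ = t≤a

threshold≤thresholdStep : ∀ a m t → t ≤ thresholdStep a m t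
threshold≤thresholdStep a m t with a <? m
... | yes _ = m≤n⊔m a t
... | no  _ = ≤-refl

1≤threshold : ∀ {n} (w : Vec ℕ n) → 1 ≤ threshold w
1≤threshold []      = s≤s z≤n
1≤threshold (a ∷ w) = ≤-trans (1≤threshold w) (threshold≤thresholdStep a (maxV w) (threshold w))

threshold≤head : ∀ {n} a (w : Vec ℕ n) → Avoid321ʳ (a ∷ w) → threshold (a ∷ w) ≤ a
threshold≤head a w (_ , t≤a) = thresholdStep-≤ a (maxV w) t≤a

∈-map⁻ : ∀ {n u} (f : ℕ → ℕ) {w : Vec ℕ n} → u ∈ map f w → ∃ λ v → v ∈ w × u ≡ f v
∈-map⁻ f u∈fw with v , v∈w , u≡fv ← find (Any.map⁻ u∈fw) = v , v∈w , u≡fv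

module StrictlyMonotone (f : ℕ → ℕ) (f-< : ∀ {u v} → u < v → f u < f v)
                        (f0≡0 : f 0 ≡ 0) (f1≡1 : f 1 ≡ 1) where

  f-≤ : ∀ {u v} → u ≤ v → f u ≤ f v
  f-≤ u≤v with m≤n⇒m<n∨m≡n u≤v
  ... | inj₁ u<v  = <⇒≤ (f-< u<v)
  ... | inj₂ refl = ≤-refl

  f-<⁻ : ∀ {u v} → f u < f v → u < v
  f-<⁻ {u} {v} fu<fv with <-cmp u v
  ... | tri< u<v _ _ = u<v
  ... | tri≈ _ refl _ = contradiction fu<fv (<-irrefl refl)
  ... | tri> _ _ v<u = contradiction fu<fv (<-asym (f-< v<u))

  f-injective : ∀ {u v} → f u ≡ f v → u ≡ v
  f-injective {u} {v} fu≡fv with <-cmp u v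
  ... | tri< u<v _ _ = contradiction fu≡fv (<⇒≢ (f-< u<v))
  ... | tri≈ _ u≡v _ = u≡v
  ... | tri> _ _ v<u = contradiction (sym fu≡fv) (<⇒≢ (f-< v<u))

  f∈map⁻ : ∀ {n v} {w : Vec ℕ n} → f v ∈ map f w → v ∈ w
  f∈map⁻ fv∈fw with u , u∈w , fv≡fu ← ∈-map⁻ f fv∈fw = subst (_∈ _) (sym (f-injective fv≡fu)) u∈w

  maxV-map : ∀ {n} (w : Vec ℕ n) → maxV (map f w) ≡ f (maxV w)
  maxV-map []      = sym f0≡0
  maxV-map (a ∷ w) = trans (cong (f a ⊔_) (maxV-map w)) (sym (mono-≤-distrib-⊔ f-≤ a (maxV w)))

  threshold-map : ∀ {n} (w : Vec ℕ n) → threshold (map f w) ≡ f (threshold w)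
  threshold-map []      = sym f1≡1
  threshold-map (a ∷ w) rewrite maxV-map w | threshold-map w with a <? maxV w
  ... | yes a<m = trans (thresholdStep-< (f (threshold w)) (f-< a<m)) (sym (mono-≤-distrib-⊔ f-≤ a (threshold w)))
  ... | no  a≮m = thresholdStep-≮ (f (threshold w)) (a≮m ∘ f-<⁻)

  Ascends-map : ∀ {n a} (w : Vec ℕ n) → Ascends (f a) (map f w) ⇔ Ascends a w
  Ascends-map []      = mk⇔ id id
  Ascends-map (b ∷ w) = mk⇔ f-<⁻ f-<

  ∉-map : ∀ {n a} (w : Vec ℕ n) → f a ∉ map f w ⇔ a ∉ w
  ∉-map w = mk⇔ (λ fa∉ a∈ → fa∉ (∈-map⁺ f a∈)) (λ a∉ fa∈ → a∉ (f∈map⁻ fa∈))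

  ModAscʳ-map : ∀ {n} (w : Vec ℕ n) → ModAscʳ (map f w) ⇔ ModAscʳ w
  ModAscʳ-map []      = mk⇔ id id
  ModAscʳ-map (a ∷ w) = mk⇔
    (λ (m , asc⇔∉) → to (ModAscʳ-map w) m , ⇔.trans (⇔.sym (Ascends-map w)) (⇔.trans asc⇔∉ (∉-map w)))
    (λ (m , asc⇔∉) → from (ModAscʳ-map w) m , ⇔.trans (Ascends-map w) (⇔.trans asc⇔∉ (⇔.sym (∉-map w))))

  Avoid321ʳ-map : ∀ {n} (w : Vec ℕ n) → Avoid321ʳ (map f w) ⇔ Avoid321ʳ w
  Avoid321ʳ-map []      = mk⇔ id id
  Avoid321ʳ-map (a ∷ w) = mk⇔
    (λ (av , t≤fa) → to (Avoid321ʳ-map w) av ,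
                      ≮⇒≥ (λ a<t → <⇒≱ (f-< a<t) (subst (_≤ f a) (threshold-map w) t≤fa)))
    (λ (av , t≤a) → from (Avoid321ʳ-map w) av , subst (_≤ f a) (sym (threshold-map w)) (f-≤ t≤a))

shift : ℕ → ℕ → ℕ
shift c v with c ≤? v
... | yes _ = suc v
... | no  _ = v

unshift : ℕ → ℕ → ℕ
unshift c v with c <? v
... | yes _ = pred v
... | no  _ = v

shift-≥ : ∀ {c v} → c ≤ v → shift c v ≡ suc v
shift-≥ {c} {v} c≤v with c ≤? v
... | yes _   = refl
... | no  c≰v = contradiction c≤v c≰v

shift-< : ∀ {c v} → v < c → shift c v ≡ v
shift-< {c} {v} v<c with c ≤? v
... | yes c≤v = contradiction v<c (≤⇒≯ c≤v)
... | no  _   = refl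

shift-mono-< : ∀ {c u v} → u < v → shift c u < shift c v
shift-mono-< {c} {u} {v} u<v with c ≤? u | c ≤? v
... | yes _   | yes _   = s≤s u<v
... | yes c≤u | no  c≰v = contradiction (≤-trans c≤u (<⇒≤ u<v)) c≰v
... | no  _   | yes _   = m<n⇒m<1+n u<v
... | no  _   | no  _   = u<v

shift≢ : ∀ c v → shift c v ≢ c
shift≢ c v with c ≤? v
... | yes c≤v = λ 1+v≡c → <⇒≱ (subst (v <_) 1+v≡c ≤-refl) c≤v
... | no  c≰v = λ v≡c → c≰v (≤-reflexive (sym v≡c))

≤-shift : ∀ c v → v ≤ shift c v
≤-shift c v with c ≤? v
... | yes _ = n≤1+n v
... | no  _ = ≤-refl

shift≤suc : ∀ c v → shift c v ≤ suc v
shift≤suc c v with c ≤? v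
... | yes _ = ≤-refl
... | no  _ = n≤1+n v

unshift-< : ∀ {c v} → v < c → unshift c v ≡ v
unshift-< {c} {v} v<c with c <? v
... | yes c<v = contradiction v<c (<-asym c<v)
... | no  _   = refl

unshift-shift : ∀ c v → unshift c (shift c v) ≡ v
unshift-shift c v with c ≤? v
... | yes c≤v with c <? suc v
...   | yes _   = refl
...   | no  c≮v = contradiction (s≤s c≤v) c≮v
unshift-shift c v | no c≰v with c <? v
...   | yes c<v = contradiction (<⇒≤ c<v) c≰v
...   | no  _   = refl

shift-unshift : ∀ c v → v ≢ c → shift c (unshift c v) ≡ v
shift-unshift c v v≢c with c <? v
shift-unshift c (suc v) v≢c | yes (s≤s c≤v) = shift-≥ c≤v
... | no c≮v = shift-< (≤∧≢⇒< (≮⇒≥ c≮v) v≢c)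

map-unshift-shift : ∀ {n} c (w : Vec ℕ n) → map (unshift c) (map (shift c) w) ≡ w
map-unshift-shift c []      = refl
map-unshift-shift c (a ∷ w) = cong₂ _∷_ (unshift-shift c a) (map-unshift-shift c w)

map-shift-unshift : ∀ {n} c (w : Vec ℕ n) → c ∉ w → map (shift c) (map (unshift c) w) ≡ w
map-shift-unshift c []      _   = refl
map-shift-unshift c (a ∷ w) c∉w =
  cong₂ _∷_ (shift-unshift c a (c∉w ∘ here ∘ sym)) (map-shift-unshift c w (c∉w ∘ there))

module Shift {c} (2≤c : 2 ≤ c) =
  StrictlyMonotone (shift c) shift-mono-< (shift-< (≤-trans (s≤s z≤n) 2≤c)) (shift-< 2≤c)

appendLetter : ∀ {n} (x : Vec ℕ (suc n)) c → Dec (c ≤ head x) → Vec ℕ (suc (suc n))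
appendLetter x c (yes _) = c ∷ x
appendLetter x c (no  _) = c ∷ map (shift c) x

child : ∀ {n} → Vec ℕ (suc n) → ℕ → Vec ℕ (suc (suc n))
child x c = appendLetter x c (c ≤? head x)

removeLast : ∀ {n} a (x : Vec ℕ (suc n)) → Dec (a ≤ head x) → Vec ℕ (suc n)
removeLast a x (yes _) = x
removeLast a x (no  _) = map (unshift a) x

parent : ∀ {n} → Vec ℕ (suc (suc n)) → Vec ℕ (suc n)
parent (a ∷ x) = removeLast a x (a ≤? head x)

child-≤ : ∀ {n c} (x : Vec ℕ (suc n)) → c ≤ head x → child x c ≡ c ∷ x
child-≤ {c = c} x c≤b = cong (appendLetter x c) (dec-yes-irr (c ≤? head x) ≤-irrelevant c≤b)

child-> : ∀ {n c} (x : Vec ℕ (suc n)) → head x < c → child x c ≡ c ∷ map (shift c) x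
child-> {c = c} x b<c = cong (appendLetter x c) (dec-no (c ≤? head x) (<⇒≱ b<c))

head-child : ∀ {n} (x : Vec ℕ (suc n)) c → head (child x c) ≡ c
head-child x c with c ≤? head x
... | yes _ = refl
... | no  _ = refl

parent-≤ : ∀ {n a} (x : Vec ℕ (suc n)) → a ≤ head x → parent (a ∷ x) ≡ x
parent-≤ {a = a} x a≤b = cong (removeLast a x) (dec-yes-irr (a ≤? head x) ≤-irrelevant a≤b)

parent-> : ∀ {n a} (x : Vec ℕ (suc n)) → head x < a → parent (a ∷ x) ≡ map (unshift a) x
parent-> {a = a} x b<a = cong (removeLast a x) (dec-no (a ≤? head x) (<⇒≱ b<a))

parent-child : ∀ {n} (x : Vec ℕ (suc n)) c → parent (child x c) ≡ x
parent-child x@(b ∷ _) c with ≤-<-connex c b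
... | inj₁ c≤b = trans (cong parent (child-≤ x c≤b)) (parent-≤ x c≤b)
... | inj₂ b<c = begin
  parent (child x c)                ≡⟨ cong parent (child-> x b<c) ⟩
  parent (c ∷ map (shift c) x)      ≡⟨ parent-> (map (shift c) x) (subst (_< c) (sym (shift-< b<c)) b<c) ⟩
  map (unshift c) (map (shift c) x) ≡⟨ map-unshift-shift c x ⟩
  x                                 ∎
  where open ≡-Reasoning

∉-map-shift : ∀ {n} c (x : Vec ℕ n) → c ∉ map (shift c) x
∉-map-shift c x c∈ with u , _ , c≡ ← ∈-map⁻ (shift c) c∈ = shift≢ c u (sym c≡)

∈-map-shift-above : ∀ {n c v} {x : Vec ℕ n} → 2 ≤ c → Gapless x →
                    c < v → v ≤ c ⊔ maxV (map (shift c) x) → v ∈ map (shift c) x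
∈-map-shift-above {c = c} {suc u} {x} 2≤c gapless-x (s≤s c≤u) v≤ =
  subst (_∈ _) (shift-≥ c≤u) (∈-map⁺ (shift c) (gapless-x (≤-trans (≤-trans (s≤s z≤n) 2≤c) c≤u) u≤K))
  where
  open Shift 2≤c
  u≤K : u ≤ maxV x
  u≤K with ⊔-sel c (maxV (map (shift c) x))
  ... | inj₁ eq = contradiction (subst (suc u ≤_) eq v≤) (<⇒≱ (s≤s c≤u))
  ... | inj₂ eq = ≤-pred (≤-trans (subst (suc u ≤_) (trans eq (maxV-map x)) v≤) (shift≤suc c (maxV x)))

gapless-shift : ∀ {n c} {x : Vec ℕ n} → 2 ≤ c → Gapless x → c ≤ suc (maxV x) →
             ∀ {v} → 1 ≤ v → v ≤ c ⊔ maxV (map (shift c) x) → v ∈ c ∷ map (shift c) x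
gapless-shift {c = c} 2≤c gapless-x c≤1+K {v} 1≤v v≤ with <-cmp v c
... | tri< v<c _ _ = there (subst (_∈ _) (shift-< v<c)
                             (∈-map⁺ (shift c) (gapless-x 1≤v (≤-pred (≤-trans v<c c≤1+K)))))
... | tri≈ _ v≡c _ = here v≡c
... | tri> _ _ c<v = there (∈-map-shift-above 2≤c gapless-x c<v v≤)

child-≤-valid : ∀ {n c} {x : Vec ℕ (suc n)} → Modasc321ʳ x → threshold x ≤ c → c ≤ head x →
                Modasc321ʳ (c ∷ x)
child-≤-valid {c = c} {x@(b ∷ _)} V t≤c c≤b = mkModasc321ʳ
  (modAsc V , mk⇔ (λ b<c → contradiction b<c (≤⇒≯ c≤b)) (λ c∉x → contradiction c∈x c∉x))
  (avoids V , t≤c)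
  (λ { (here refl) → 1≤c ; (there v∈x) → positive V v∈x })
  (λ 1≤v v≤ → there (gapless V 1≤v (subst (_ ≤_) (m≤n⇒m⊔n≡n c≤K) v≤)))
  where
  1≤c : 1 ≤ c
  1≤c = ≤-trans (1≤threshold x) t≤c
  c≤K : c ≤ maxV x
  c≤K = ≤-trans c≤b (∈⇒≤maxV {w = x} (here refl))
  c∈x : c ∈ x
  c∈x = gapless V 1≤c c≤K

child->-valid : ∀ {n c} {x : Vec ℕ (suc n)} → Modasc321ʳ x → head x < c → c ≤ suc (maxV x) →
                Modasc321ʳ (c ∷ map (shift c) x)
child->-valid {c = c} {x@(b ∷ _)} V b<c c≤1+K = mkModasc321ʳ
  (from (ModAscʳ-map x) (modAsc V) , mk⇔ (λ _ → ∉-map-shift c x) (λ _ → subst (_< c) (sym (shift-< b<c)) b<c))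
  (from (Avoid321ʳ-map x) (avoids V) ,
   ≤-trans (≤-reflexive (trans (threshold-map x) (shift-< t<c))) (<⇒≤ t<c))
  (λ { (here refl) → ≤-trans (s≤s z≤n) 2≤c ; (there v∈x′) → positive-shift v∈x′ })
  (gapless-shift 2≤c (gapless V) c≤1+K)
  where
  2≤c : 2 ≤ c
  2≤c = ≤-trans (s≤s (positive V (here refl))) b<c
  open Shift 2≤c
  t<c : threshold x < c
  t<c = ≤-<-trans (threshold≤head b _ (avoids V)) b<c
  positive-shift : ∀ {v} → v ∈ map (shift c) x → 1 ≤ v
  positive-shift v∈ with u , u∈x , refl ← ∈-map⁻ (shift c) v∈ = ≤-trans (positive V u∈x) (≤-shift c u)

child-valid : ∀ {n c} {x : Vec ℕ (suc n)} → Modasc321ʳ x → threshold x ≤ c → c ≤ suc (maxV x) →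
              Modasc321ʳ (child x c)
child-valid {c = c} {x@(b ∷ _)} V t≤c c≤1+K with ≤-<-connex c b
... | inj₁ c≤b = subst Modasc321ʳ (sym (child-≤ x c≤b)) (child-≤-valid V t≤c c≤b)
... | inj₂ b<c = subst Modasc321ʳ (sym (child-> x b<c)) (child->-valid V b<c c≤1+K)

maxV-child : ∀ {n c} (x : Vec ℕ (suc n)) → Modasc321ʳ x → c ≤ suc (maxV x) →
             maxV (child x c) ≤ suc (maxV x)
maxV-child {c = c} x@(b ∷ _) V c≤1+K with ≤-<-connex c b
... | inj₁ c≤b rewrite child-≤ x c≤b = ⊔-lub c≤1+K (n≤1+n (maxV x))
... | inj₂ b<c rewrite child-> x b<c =
  ⊔-lub c≤1+K (≤-trans (≤-reflexive (maxV-map x)) (shift≤suc c (maxV x)))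
  where open Shift (≤-trans (s≤s (positive V (here refl))) b<c)

Admissible : ∀ {n} → Vec ℕ n → ℕ → Set
Admissible x c = threshold x ≤ c × c ≤ suc (maxV x)

parent-≤-valid : ∀ {n a} {x : Vec ℕ (suc n)} → Modasc321ʳ (a ∷ x) → a ≤ head x →
                 Modasc321ʳ x × Admissible x a
parent-≤-valid {a = a} {x@(b ∷ _)} V a≤b =
  mkModasc321ʳ (proj₁ (modAsc V)) (proj₁ (avoids V)) (positive V ∘ there) gapless-x ,
  proj₂ (avoids V) , ≤-trans (∈⇒≤maxV a∈x) (n≤1+n (maxV x))
  where
  a∈x : a ∈ x
  a∈x with a ∈? x
  ... | yes a∈x = a∈x
  ... | no  a∉x = contradiction (from (proj₂ (modAsc V)) a∉x) (≤⇒≯ a≤b)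
  gapless-x : Gapless x
  gapless-x 1≤v v≤K with gapless V 1≤v (≤-trans v≤K (m≤n⊔m a (maxV x)))
  ... | here refl = a∈x
  ... | there v∈x = v∈x

module _ {n a b} {w : Vec ℕ n} (V : Modasc321ʳ (a ∷ b ∷ w)) (b<a : b < a) where

  private
    x = b ∷ w
    a∉x : a ∉ x
    a∉x = to (proj₂ (modAsc V)) b<a
    2≤a : 2 ≤ a
    2≤a = ≤-trans (s≤s (positive V (there (here refl)))) b<a
    x′ = map (unshift a) x
    shift-x′ : map (shift a) x′ ≡ x
    shift-x′ = map-shift-unshift a x a∉x
    shift∈x : ∀ {v} → v ∈ x′ → shift a v ∈ x
    shift∈x {v} v∈ = subst (shift a v ∈_) shift-x′ (∈-map⁺ (shift a) v∈)
    open Shift 2≤a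

  parent->-valid : Modasc321ʳ x′
  parent->-valid = mkModasc321ʳ
    (to (ModAscʳ-map x′) (subst ModAscʳ (sym shift-x′) (proj₁ (modAsc V))))
    (to (Avoid321ʳ-map x′) (subst Avoid321ʳ (sym shift-x′) (proj₁ (avoids V))))
    positive′ gapless′
    where
    positive′ : ∀ {v} → v ∈ x′ → 1 ≤ v
    positive′ {zero}  0∈ = contradiction (positive V (there (shift∈x 0∈))) (λ 1≤ → <-irrefl (sym f0≡0) 1≤)
      where f0≡0 = shift-< (≤-trans (s≤s z≤n) 2≤a)
    positive′ {suc v} _  = s≤s z≤n
    gapless′ : Gapless x′
    gapless′ {v} 1≤v v≤K′ with gapless V (≤-trans 1≤v (≤-shift a v)) shift-v≤
      where
      shift-v≤ : shift a v ≤ maxV (a ∷ x)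
      shift-v≤ = ≤-trans (f-≤ v≤K′) (≤-trans (≤-reflexive (trans (sym (maxV-map x′)) (cong maxV shift-x′)))
                                               (m≤n⊔m a (maxV x)))
    ... | here sv≡a  = contradiction sv≡a (shift≢ a v)
    ... | there sv∈x = f∈map⁻ (subst (shift a v ∈_) (sym shift-x′) sv∈x)

  parent->-admissible : Admissible x′ a
  parent->-admissible =
    ≤-trans (threshold≤head _ _ (avoids parent->-valid)) (≤-trans (≤-reflexive b′≡b) (<⇒≤ b<a)) , a≤1+K′
    where
    b′≡b : unshift a b ≡ b
    b′≡b = unshift-< b<a
    -- Otherwise 1 + max x′ < a is a value of a ∷ x other than a, hence the image of a value of x′.
    a≤1+K′ : a ≤ suc (maxV x′)
    a≤1+K′ with a ≤? suc (maxV x′)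
    ... | yes a≤ = a≤
    ... | no  a≰ with gapless V (s≤s z≤n) (≤-trans (<⇒≤ (≰⇒> a≰)) (m≤m⊔n a (maxV x)))
    ...   | here 1+K′≡a = contradiction 1+K′≡a (<⇒≢ (≰⇒> a≰))
    ...   | there 1+K′∈x
      with u , u∈x′ , 1+K′≡ ← ∈-map⁻ (shift a) (subst (suc (maxV x′) ∈_) (sym shift-x′) 1+K′∈x) =
      contradiction (≤-reflexive (trans 1+K′≡ (shift-< u<a))) (<⇒≱ (s≤s (∈⇒≤maxV u∈x′)))
      where
      u<a : u < a
      u<a = ≤-<-trans (∈⇒≤maxV u∈x′) (<-trans (n<1+n _) (≰⇒> a≰))

  child-parent-> : child x′ a ≡ a ∷ x
  child-parent-> = trans (child-> x′ (subst (_< a) (sym (unshift-< b<a)) b<a)) (cong (a ∷_) shift-x′)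

parent-valid : ∀ {n} {y : Vec ℕ (suc (suc n))} → Modasc321ʳ y →
               Modasc321ʳ (parent y) × Admissible (parent y) (head y) × child (parent y) (head y) ≡ y
parent-valid {y = a ∷ x@(b ∷ _)} V with ≤-<-connex a b
... | inj₁ a≤b rewrite parent-≤ x a≤b =
  proj₁ (parent-≤-valid V a≤b) , proj₂ (parent-≤-valid V a≤b) , child-≤ x a≤b
... | inj₂ b<a rewrite parent-> x b<a =
  parent->-valid V b<a , parent->-admissible V b<a , child-parent-> V b<a

module Labels {n b} {w : Vec ℕ n} (V : Modasc321ʳ (b ∷ w)) where

  private
    x = b ∷ w
    K = maxV x
    t = threshold x

  t≤b : t ≤ b
  t≤b = threshold≤head b w (avoids V)

  b≤K : b ≤ K
  b≤K = ∈⇒≤maxV {w = x} (here refl)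

  t≤K : t ≤ K
  t≤K = ≤-trans t≤b b≤K

  t≡b : b < K → t ≡ b
  t≡b b<K = trans (thresholdStep-< (threshold w) b<m) (m≥n⇒m⊔n≡m (proj₂ (avoids V)))
    where
    b<m : b < maxV w
    b<m with ⊔-sel b (maxV w)
    ... | inj₁ eq = contradiction (subst (b <_) eq b<K) (<-irrefl refl)
    ... | inj₂ eq = subst (b <_) eq b<K

  label-child-≤ : ∀ {c} → c ≤ b → t ≤ c → c < K → label (child x c) ≡ K ∸ c
  label-child-≤ c≤b t≤c c<K rewrite child-≤ x c≤b =
    cong₂ _∸_ (m≤n⇒m⊔n≡n (<⇒≤ c<K)) (trans (thresholdStep-< t c<K) (m≥n⇒m⊔n≡m t≤c))

  label-child-K : b ≡ K → label (child x K) ≡ K ∸ t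
  label-child-K b≡K rewrite child-≤ x (≤-reflexive (sym b≡K)) =
    cong₂ _∸_ (⊔-idem K) (thresholdStep-≮ {K} {K} t (<-irrefl refl))

  module _ {c} (b<c : b < c) where
    private
      open Shift (≤-trans (s≤s (positive V (here refl))) b<c)
      t′≡t : threshold (map (shift c) x) ≡ t
      t′≡t = trans (threshold-map x) (shift-< (≤-<-trans t≤b b<c))

    label-child-> : c ≤ K → label (child x c) ≡ suc K ∸ c
    label-child-> c≤K rewrite child-> x b<c | maxV-map x | t′≡t | shift-≥ c≤K =
      cong₂ _∸_ (m≤n⇒m⊔n≡n (m≤n⇒m≤1+n c≤K))
                (trans (thresholdStep-< t (s≤s c≤K)) (m≥n⇒m⊔n≡m (<⇒≤ (≤-<-trans t≤b b<c))))

    label-child-1+K : c ≡ suc K → label (child x c) ≡ suc K ∸ t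
    label-child-1+K refl rewrite child-> x b<c | maxV-map x | t′≡t | shift-< (n<1+n K) =
      cong₂ _∸_ (m≥n⇒m⊔n≡m (n≤1+n K)) (thresholdStep-≮ t (<-asym (n<1+n K)))

children : ∀ {n} → Vec ℕ (suc n) → List (Vec ℕ (suc (suc n)))
children x = applyUpTo (λ k → child x (threshold x + k)) (2 + label x)

module ChildSums {n b} {w : Vec ℕ n} (V : Modasc321ʳ (b ∷ w)) (F : ℕ → ℕ) where

  open Labels V
  open ≡-Reasoning

  private
    x = b ∷ w
    K = maxV x
    t = threshold x
    h = label x
    g : ℕ → ℕ
    g k = F (label (child x (t + k)))
    t+h≡K : t + h ≡ K
    t+h≡K = m+[n∸m]≡n t≤K
    K∸[t+k]≡h∸k : ∀ k → K ∸ (t + k) ≡ h ∸ k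
    K∸[t+k]≡h∸k k = sym (∸-+-assoc K t k)
    g[1+h]≡ : b < t + suc h → g (suc h) ≡ F (suc h)
    g[1+h]≡ b< = cong F (trans (label-child-1+K b< (trans (+-suc t h) (cong suc t+h≡K))) (+-∸-assoc 1 t≤K))

  -- The labels of the children, in the order of their last letters, are h, h, h − 1, …, 1, h + 1.
  ∑-children-< : b < K → ∑[ k < 2 + h ] g k ≡ succession F h
  ∑-children-< b<K = begin
    ∑[ k < 2 + h ] g k
      ≡⟨ ∑<-suc (suc h) g ⟩
    g 0 + (∑[ l < h ] g (suc l) + g (suc h))
      ≡⟨ cong₂ (λ u v → u + (v + g (suc h))) g0≡ (∑<-cong h g[1+l]≡) ⟩
    F h + (∑[ l < h ] F (h ∸ l) + g (suc h))
      ≡⟨ cong₂ (λ u v → F h + (u + v)) (∑<-reverse h F) (g[1+h]≡ b<t+1+h) ⟩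
    succession F h ∎
    where
    t≡b′ = t≡b b<K
    g0≡ : g 0 ≡ F h
    g0≡ = cong F (trans (label-child-≤ (≤-trans (≤-reflexive (+-identityʳ t)) t≤b) (m≤m+n t 0)
                                        (≤-<-trans (≤-reflexive (trans (+-identityʳ t) t≡b′)) b<K))
                        (cong (K ∸_) (+-identityʳ t)))
    b<t+1+ : ∀ l → b < t + suc l
    b<t+1+ l = subst (_< t + suc l) t≡b′ (m<m+n t (s≤s z≤n))
    b<t+1+h = b<t+1+ h
    g[1+l]≡ : ∀ l → l < h → g (suc l) ≡ F (h ∸ l)
    g[1+l]≡ l l<h = cong F (trans (label-child-> (b<t+1+ l) (subst (t + suc l ≤_) t+h≡K (+-monoʳ-≤ t l<h)))
                                  (trans (cong (suc K ∸_) (+-suc t l)) (K∸[t+k]≡h∸k l)))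

  -- The labels of the children, in the order of their last letters, are h, h − 1, …, 1, h, h + 1.
  ∑-children-≡ : b ≡ K → ∑[ k < 2 + h ] g k ≡ succession F h
  ∑-children-≡ b≡K = begin
    ∑[ k < h ] g k + g h + g (suc h)
      ≡⟨ cong₂ (λ u v → u + v + g (suc h)) (∑<-cong h g[k]≡) gh≡ ⟩
    ∑[ k < h ] F (h ∸ k) + F h + g (suc h)
      ≡⟨ cong₂ (λ u v → u + F h + v) (∑<-reverse h F) (g[1+h]≡ b<t+1+h) ⟩
    ∑[ k < h ] F (suc k) + F h + F (suc h)
      ≡⟨ xy∙z≈y∙xz (∑[ k < h ] F (suc k)) (F h) (F (suc h)) ⟩
    succession F h ∎
    where
    b<t+1+h : b < t + suc h
    b<t+1+h = subst (_< t + suc h) (sym b≡K) (subst (K <_) (sym (trans (+-suc t h) (cong suc t+h≡K))) (n<1+n K))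
    gh≡ : g h ≡ F h
    gh≡ = cong F (trans (cong (λ c → label (child x c)) t+h≡K) (label-child-K b≡K))
    g[k]≡ : ∀ k → k < h → g k ≡ F (h ∸ k)
    g[k]≡ k k<h = cong F (trans (label-child-≤ (subst (t + k ≤_) (sym b≡K) (<⇒≤ t+k<K)) (m≤m+n t k) t+k<K)
                                (K∸[t+k]≡h∸k k))
      where
      t+k<K : t + k < K
      t+k<K = subst (t + k <_) t+h≡K (+-monoʳ-< t k<h)

sum-children : ∀ {n} {x : Vec ℕ (suc n)} (F : ℕ → ℕ) → Modasc321ʳ x →
               sum (List.map (F ∘ label) (children x)) ≡ succession F (label x)
sum-children {x = x@(b ∷ _)} F V =
  trans (sum-map-applyUpTo (F ∘ label) (λ k → child x (threshold x + k)) (2 + label x))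
        ([ ∑-children-< , ∑-children-≡ ]′ (m≤n⇒m<n∨m≡n (Labels.b≤K V)))
  where open ChildSums V F

∈-children⁻ : ∀ {n y} {x : Vec ℕ (suc n)} → Modasc321ʳ x → y ∈ₗ children x →
              ∃ λ c → Admissible x c × y ≡ child x c
∈-children⁻ {x = x@(_ ∷ _)} V y∈ with k , k<2+h , refl ← ∈-applyUpTo⁻ (λ k → child x (threshold x + k)) y∈ =
  threshold x + k , (m≤m+n (threshold x) k , t+k≤1+K) , refl
  where
  t+k≤1+K : threshold x + k ≤ suc (maxV x)
  t+k≤1+K = begin
    threshold x + k               ≤⟨ +-monoʳ-≤ (threshold x) (≤-pred k<2+h) ⟩
    threshold x + suc (label x)   ≡⟨ +-suc (threshold x) (label x) ⟩
    suc (threshold x + label x)   ≡⟨ cong suc (m+[n∸m]≡n (Labels.t≤K V)) ⟩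
    suc (maxV x)                  ∎
    where open ≤-Reasoning

∈-children⁺ : ∀ {n c} {x : Vec ℕ (suc n)} → Modasc321ʳ x → Admissible x c → child x c ∈ₗ children x
∈-children⁺ {c = c} {x@(_ ∷ _)} V (t≤c , c≤1+K) =
  subst (λ d → child x d ∈ₗ children x) (m+[n∸m]≡n t≤c)
        (∈-applyUpTo⁺ (λ k → child x (threshold x + k)) (s≤s c∸t≤1+h))
  where
  c∸t≤1+h : c ∸ threshold x ≤ suc (label x)
  c∸t≤1+h = ≤-trans (∸-monoˡ-≤ (threshold x) c≤1+K)
                    (≤-reflexive (+-∸-assoc 1 (Labels.t≤K V)))

parent-∈-children : ∀ {n y} {x : Vec ℕ (suc n)} → y ∈ₗ children x → parent y ≡ x
parent-∈-children {x = x} y∈ with k , _ , refl ← ∈-applyUpTo⁻ (λ k → child x (threshold x + k)) y∈ =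
  parent-child x (threshold x + k)

children-unique : ∀ {n} (x : Vec ℕ (suc n)) → Unique (children x)
children-unique x = applyUpTo⁺₁ (λ k → child x (threshold x + k)) (2 + label x)
  (λ i<j _ eq → <⇒≢ i<j (+-cancelˡ-≡ (threshold x) _ _
    (trans (sym (head-child x _)) (trans (cong head eq) (head-child x _)))))

level : (n : ℕ) → List (Vec ℕ (suc n))
level zero    = (1 ∷ []) ∷ []
level (suc n) = concatMap children (level n)

level-unique : ∀ n → Unique (level n)
level-unique zero    = All.[] ∷ []
level-unique (suc n) = concat⁺ (All.map⁺ (All.tabulate (λ {x} _ → children-unique x)))
                               (AllPairs.map⁺ (AllPairs.map children-disjoint (level-unique n)))
  where
  children-disjoint : ∀ {x x′ : Vec ℕ (suc n)} → x ≢ x′ → Disjoint (children x) (children x′)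
  children-disjoint x≢x′ (y∈ , y∈′) = x≢x′ (trans (sym (parent-∈-children y∈)) (parent-∈-children y∈′))

level-sound : ∀ n {y} → y ∈ₗ level n → Modasc321ʳ y × maxV y ≤ suc n
level-sound zero (Anyₗ.here refl) =
  mkModasc321ʳ (tt , mk⇔ (λ _ ()) (λ _ → tt)) (tt , ≤-refl) (λ { (here refl) → ≤-refl })
               (λ { 1≤v v≤1 → here (≤-antisym v≤1 1≤v) }) ,
  ≤-refl
level-sound (suc n) y∈
  with x , x∈ , y∈children ← findₗ (∈-concatMap⁻ children y∈)
  with Vx , Kx≤1+n ← level-sound n x∈
  with c , (t≤c , c≤1+K) , refl ← ∈-children⁻ Vx y∈children
  = child-valid Vx t≤c c≤1+K , ≤-trans (maxV-child x Vx c≤1+K) (s≤s Kx≤1+n)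

level-complete : ∀ n {y : Vec ℕ (suc n)} → Modasc321ʳ y → y ∈ₗ level n
level-complete zero {a ∷ []} V
  with gapless V ≤-refl (subst (1 ≤_) (sym (⊔-identityʳ a)) (positive V (here refl)))
... | here refl = Anyₗ.here refl
level-complete (suc n) {y} V with Vx , adm , child≡y ← parent-valid V =
  ∈-concatMap⁺ children (Anyₗ.map (λ { refl → subst (_∈ₗ children (parent y)) child≡y (∈-children⁺ Vx adm) })
                                   (level-complete n Vx))

sum-level : ∀ n F → sum (List.map (F ∘ label) (level n)) ≡ iterate succession n F 0
sum-level zero    F = +-identityʳ (F 0)
sum-level (suc n) F = begin
  sum (List.map (F ∘ label) (concatMap children (level n)))
    ≡⟨ sum-map-concatMap (F ∘ label) children (level n) ⟩
  sum (List.map (λ x → sum (List.map (F ∘ label) (children x))) (level n))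
    ≡⟨ cong sum (map-cong-local (All.tabulate (λ x∈ → sum-children F (proj₁ (level-sound n x∈))))) ⟩
  sum (List.map (succession F ∘ label) (level n))
    ≡⟨ sum-level n (succession F) ⟩
  iterate succession n (succession F) 0 ∎
  where open ≡-Reasoning

length-level : ∀ n → length (level n) ≡ iterate succession n (λ _ → 1) 0
length-level n = trans (length≡sum-map-1 (level n)) (sum-level n (λ _ → 1))

-- Back from reversed words to the definitions

lookup-∷ʳ-last : ∀ {A : Set} {n} (u : Vec A n) a → lookup (u ∷ʳ a) (fromℕ n) ≡ a
lookup-∷ʳ-last []      a = refl
lookup-∷ʳ-last (b ∷ u) a = lookup-∷ʳ-last u a

lookup-∷ʳ-inject₁ : ∀ {A : Set} {n} (u : Vec A n) a i → lookup (u ∷ʳ a) (inject₁ i) ≡ lookup u i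
lookup-∷ʳ-inject₁ (b ∷ u) a zero    = refl
lookup-∷ʳ-inject₁ (b ∷ u) a (suc i) = lookup-∷ʳ-inject₁ u a i

lookup-reverse-last : ∀ {A : Set} {n} a (w : Vec A n) → lookup (reverse (a ∷ w)) (fromℕ n) ≡ a
lookup-reverse-last a w rewrite reverse-∷ a w = lookup-∷ʳ-last (reverse w) a

lookup-reverse-inject₁ : ∀ {A : Set} {n} a (w : Vec A n) i →
                         lookup (reverse (a ∷ w)) (inject₁ i) ≡ lookup (reverse w) i
lookup-reverse-inject₁ a w i rewrite reverse-∷ a w = lookup-∷ʳ-inject₁ (reverse w) a i

toℕ<n⇒inject₁ : ∀ {n} (i : Fin (suc n)) → toℕ i < n → ∃ λ j → i ≡ inject₁ j
toℕ<n⇒inject₁ i i<n = lower₁ i n≢i , sym (inject₁-lower₁ i n≢i)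
  where n≢i = λ n≡i → <-irrefl (sym n≡i) i<n

∃-lookup⇔∈ : ∀ {n v} (z : Vec ℕ n) → (∃ λ i → lookup z i ≡ v) ⇔ v ∈ z
∃-lookup⇔∈ z = mk⇔ (λ (i , zᵢ≡v) → subst (_∈ z) zᵢ≡v (∈-lookup i z))
                   (λ v∈z → index v∈z , sym (lookup-index v∈z))

lookup-reverse-∈ : ∀ {n} (w : Vec ℕ n) i → lookup (reverse w) i ∈ w
lookup-reverse-∈ (a ∷ w) i with view i
... | ‵fromℕ         = here (lookup-reverse-last a w)
... | ‵inj₁ {i = j} _ = there (subst (_∈ w) (sym (lookup-reverse-inject₁ a w j)) (lookup-reverse-∈ w j))

∈⇒lookup-reverse : ∀ {n v} (w : Vec ℕ n) → v ∈ w → ∃ λ i → lookup (reverse w) i ≡ v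
∈⇒lookup-reverse (a ∷ w) (here refl) = fromℕ _ , lookup-reverse-last a w
∈⇒lookup-reverse (a ∷ w) (there v∈w) with i , wᵢ≡v ← ∈⇒lookup-reverse w v∈w =
  inject₁ i , trans (lookup-reverse-inject₁ a w i) wᵢ≡v

∈-reverse : ∀ {n v} (w : Vec ℕ n) → v ∈ reverse w ⇔ v ∈ w
∈-reverse w = mk⇔ (λ v∈ → subst (_∈ w) (sym (lookup-index v∈)) (lookup-reverse-∈ w (index v∈)))
                  (to (∃-lookup⇔∈ (reverse w)) ∘ ∈⇒lookup-reverse w)

AscentTopAt : ∀ {n} → Vec ℕ n → Fin n → Set
AscentTopAt {n} z i = toℕ i ≡ 0 ⊎ ∃ λ (j : Fin n) → suc (toℕ j) ≡ toℕ i × lookup z j < lookup z i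

LeftmostAt : ∀ {n} → Vec ℕ n → Fin n → Set
LeftmostAt {n} z i = ∀ (j : Fin n) → toℕ j < toℕ i → lookup z j ≢ lookup z i

IsModAsc⇔ : ∀ {n} (z : Vec ℕ n) → (∀ i → 1 ≤ lookup z i) →
            (∀ i v → AscentTop z i v ⇔ LeftmostCopy z i v) ⇔ (∀ i → AscentTopAt z i ⇔ LeftmostAt z i)
IsModAsc⇔ z positive = mk⇔
  (λ tops⇔copies i → mk⇔ (λ top → proj₂ (proj₂ (proj₂ (to (tops⇔copies i _) (refl , top)))))
                         (λ leftmost → proj₂ (from (tops⇔copies i _) (copy i leftmost))))
  (λ at⇔lm i v → mk⇔ (λ { (refl , top) → copy i (to (at⇔lm i) top) })
                     (λ { (_ , _ , refl , leftmost) → refl , from (at⇔lm i) leftmost }))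
  where
  copy : ∀ i → LeftmostAt z i → LeftmostCopy z i (lookup z i)
  copy i leftmost = positive i , ∈⇒≤maxV (∈-lookup i z) , refl , leftmost

Has321 : ∀ {n} → Vec ℕ n → Set
Has321 {n} z = ∃ λ (i : Fin n) → ∃ λ (j : Fin n) → ∃ λ (l : Fin n) →
  toℕ i < toℕ j × toℕ j < toℕ l × lookup z j < lookup z i × lookup z l < lookup z j

-- The inversions that a final letter c would extend to a 321.
InversionAbove : ∀ {n} → Vec ℕ n → ℕ → Set
InversionAbove {n} z c = ∃ λ (i : Fin n) → ∃ λ (j : Fin n) →
  toℕ i < toℕ j × lookup z j < lookup z i × c < lookup z j

module ReverseCons {n} (a : ℕ) (w : Vec ℕ n) where

  private
    z = reverse (a ∷ w)
    u = reverse w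
    last = lookup-reverse-last a w
    init = lookup-reverse-inject₁ a w

  AscentTopAt-inject₁ : ∀ j → AscentTopAt z (inject₁ j) ⇔ AscentTopAt u j
  AscentTopAt-inject₁ j = mk⇔ ⇒ ⇐
    where
    ⇒ : AscentTopAt z (inject₁ j) → AscentTopAt u j
    ⇒ (inj₁ j≡0) = inj₁ (trans (sym (toℕ-inject₁ j)) j≡0)
    ⇒ (inj₂ (k , 1+k≡j , zₖ<zⱼ))
      with k′ , refl ← toℕ<n⇒inject₁ k (≤-trans (≤-reflexive (trans 1+k≡j (toℕ-inject₁ j))) (<⇒≤ (toℕ<n j))) =
      inj₂ (k′ , trans (cong suc (sym (toℕ-inject₁ k′))) (trans 1+k≡j (toℕ-inject₁ j)) ,
            subst₂ _<_ (init k′) (init j) zₖ<zⱼ)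
    ⇐ : AscentTopAt u j → AscentTopAt z (inject₁ j)
    ⇐ (inj₁ j≡0) = inj₁ (trans (toℕ-inject₁ j) j≡0)
    ⇐ (inj₂ (k , 1+k≡j , uₖ<uⱼ)) =
      inj₂ (inject₁ k , trans (cong suc (toℕ-inject₁ k)) (trans 1+k≡j (sym (toℕ-inject₁ j))) ,
            subst₂ _<_ (sym (init k)) (sym (init j)) uₖ<uⱼ)

  LeftmostAt-inject₁ : ∀ j → LeftmostAt z (inject₁ j) ⇔ LeftmostAt u j
  LeftmostAt-inject₁ j = mk⇔ ⇒ ⇐
    where
    ⇒ : LeftmostAt z (inject₁ j) → LeftmostAt u j
    ⇒ leftmost k k<j uₖ≡uⱼ = leftmost (inject₁ k) (subst₂ _<_ (sym (toℕ-inject₁ k)) (sym (toℕ-inject₁ j)) k<j)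
                                       (trans (init k) (trans uₖ≡uⱼ (sym (init j))))
    ⇐ : LeftmostAt u j → LeftmostAt z (inject₁ j)
    ⇐ leftmost k k<j with k′ , refl ← toℕ<n⇒inject₁ k (<-trans (subst (toℕ k <_) (toℕ-inject₁ j) k<j) (toℕ<n j)) =
      λ zₖ≡zⱼ → leftmost k′ (subst₂ _<_ (toℕ-inject₁ k′) (toℕ-inject₁ j) k<j)
                            (trans (sym (init k′)) (trans zₖ≡zⱼ (init j)))

  LeftmostAt-last : LeftmostAt z (fromℕ n) ⇔ a ∉ w
  LeftmostAt-last = mk⇔ ⇒ ⇐
    where
    ⇒ : LeftmostAt z (fromℕ n) → a ∉ w
    ⇒ leftmost a∈w with k , uₖ≡a ← ∈⇒lookup-reverse w a∈w =
      leftmost (inject₁ k) (subst₂ _<_ (sym (toℕ-inject₁ k)) (sym (toℕ-fromℕ n)) (toℕ<n k))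
               (trans (init k) (trans uₖ≡a (sym last)))
    ⇐ : a ∉ w → LeftmostAt z (fromℕ n)
    ⇐ a∉w k k<n with k′ , refl ← toℕ<n⇒inject₁ k (subst (toℕ k <_) (toℕ-fromℕ n) k<n) =
      λ zₖ≡a → a∉w (subst (_∈ w) (trans (sym (init k′)) (trans zₖ≡a last)) (lookup-reverse-∈ w k′))


  private
    toℕ<n⇒inject₁′ : ∀ (j l : Fin (suc n)) → toℕ j < toℕ l → ∃ λ j′ → j ≡ inject₁ j′
    toℕ<n⇒inject₁′ j l j<l = toℕ<n⇒inject₁ j (≤-trans j<l (≤-pred (toℕ<n l)))
    inj< : ∀ {i j : Fin n} → toℕ i < toℕ j → toℕ (inject₁ i) < toℕ (inject₁ j)
    inj< {i} {j} = subst₂ _<_ (sym (toℕ-inject₁ i)) (sym (toℕ-inject₁ j))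
    inj<⁻ : ∀ {i j : Fin n} → toℕ (inject₁ i) < toℕ (inject₁ j) → toℕ i < toℕ j
    inj<⁻ {i} {j} = subst₂ _<_ (toℕ-inject₁ i) (toℕ-inject₁ j)
    inj<last : ∀ (i : Fin n) → toℕ (inject₁ i) < toℕ (fromℕ n)
    inj<last i = subst₂ _<_ (sym (toℕ-inject₁ i)) (sym (toℕ-fromℕ n)) (toℕ<n i)

  Has321-∷ : Has321 z ⇔ (Has321 u ⊎ InversionAbove u a)
  Has321-∷ = mk⇔ ⇒ ⇐
    where
    ⇒ : Has321 z → Has321 u ⊎ InversionAbove u a
    ⇒ (i , j , l , i<j , j<l , zⱼ<zᵢ , zₗ<zⱼ)
      with j′ , refl ← toℕ<n⇒inject₁′ j l j<l
      with i′ , refl ← toℕ<n⇒inject₁′ i (inject₁ j′) i<j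
      with view l
    ... | ‵fromℕ = inj₂ (i′ , j′ , inj<⁻ i<j , subst₂ _<_ (init j′) (init i′) zⱼ<zᵢ ,
                         subst₂ _<_ last (init j′) zₗ<zⱼ)
    ... | ‵inj₁ {i = l′} _ = inj₁ (i′ , j′ , l′ , inj<⁻ i<j , inj<⁻ j<l ,
                                  subst₂ _<_ (init j′) (init i′) zⱼ<zᵢ , subst₂ _<_ (init l′) (init j′) zₗ<zⱼ)
    ⇐ : Has321 u ⊎ InversionAbove u a → Has321 z
    ⇐ (inj₁ (i , j , l , i<j , j<l , uⱼ<uᵢ , uₗ<uⱼ)) =
      inject₁ i , inject₁ j , inject₁ l , inj< i<j , inj< j<l ,
      subst₂ _<_ (sym (init j)) (sym (init i)) uⱼ<uᵢ , subst₂ _<_ (sym (init l)) (sym (init j)) uₗ<uⱼ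
    ⇐ (inj₂ (i , j , i<j , uⱼ<uᵢ , a<uⱼ)) =
      inject₁ i , inject₁ j , fromℕ n , inj< i<j , inj<last j ,
      subst₂ _<_ (sym (init j)) (sym (init i)) uⱼ<uᵢ , subst₂ _<_ (sym last) (sym (init j)) a<uⱼ

  InversionAbove-∷ : ∀ c → InversionAbove z c ⇔ (InversionAbove u c ⊎ ((∃ λ i → a < lookup u i) × c < a))
  InversionAbove-∷ c = mk⇔ ⇒ ⇐
    where
    ⇒ : InversionAbove z c → InversionAbove u c ⊎ ((∃ λ i → a < lookup u i) × c < a)
    ⇒ (i , j , i<j , zⱼ<zᵢ , c<zⱼ) with i′ , refl ← toℕ<n⇒inject₁′ i j i<j with view j
    ... | ‵fromℕ = inj₂ ((i′ , subst₂ _<_ last (init i′) zⱼ<zᵢ) , subst (c <_) last c<zⱼ)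
    ... | ‵inj₁ {i = j′} _ = inj₁ (i′ , j′ , inj<⁻ i<j , subst₂ _<_ (init j′) (init i′) zⱼ<zᵢ ,
                                  subst (c <_) (init j′) c<zⱼ)
    ⇐ : InversionAbove u c ⊎ ((∃ λ i → a < lookup u i) × c < a) → InversionAbove z c
    ⇐ (inj₁ (i , j , i<j , uⱼ<uᵢ , c<uⱼ)) =
      inject₁ i , inject₁ j , inj< i<j , subst₂ _<_ (sym (init j)) (sym (init i)) uⱼ<uᵢ ,
      subst (c <_) (sym (init j)) c<uⱼ
    ⇐ (inj₂ ((i , a<uᵢ) , c<a)) =
      inject₁ i , fromℕ n , inj<last i , subst₂ _<_ (sym last) (sym (init i)) a<uᵢ , subst (c <_) (sym last) c<a

AscentTopAt-reverse-last : ∀ {n} a (w : Vec ℕ n) → AscentTopAt (reverse (a ∷ w)) (fromℕ n) ⇔ Ascends a w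
AscentTopAt-reverse-last a []                = mk⇔ (λ _ → tt) (λ _ → inj₁ refl)
AscentTopAt-reverse-last {suc n} a w@(b ∷ w′) = mk⇔ ⇒ ⇐
  where
  z = reverse (a ∷ w)
  penultimate : lookup z (inject₁ (fromℕ n)) ≡ b
  penultimate = trans (lookup-reverse-inject₁ a w (fromℕ n)) (lookup-reverse-last b w′)
  ⇒ : AscentTopAt z (fromℕ (suc n)) → b < a
  ⇒ (inj₂ (k , 1+k≡1+n , zₖ<a)) =
    subst₂ _<_ (trans (cong (lookup z) k≡) penultimate) (lookup-reverse-last a w) zₖ<a
    where
    k≡ : k ≡ inject₁ (fromℕ n)
    k≡ = toℕ-injective (trans (suc-injective 1+k≡1+n) (sym (toℕ-inject₁ (fromℕ n))))
  ⇐ : b < a → AscentTopAt z (fromℕ (suc n))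
  ⇐ b<a = inj₂ (inject₁ (fromℕ n) , cong suc (toℕ-inject₁ (fromℕ n)) ,
               subst₂ _<_ (sym penultimate) (sym (lookup-reverse-last a w)) b<a)

ModAscʳ⇔ : ∀ {n} (w : Vec ℕ n) →
           ModAscʳ w ⇔ (∀ i → AscentTopAt (reverse w) i ⇔ LeftmostAt (reverse w) i)
ModAscʳ⇔ []      = mk⇔ (λ _ ()) (λ _ → tt)
ModAscʳ⇔ (a ∷ w) = mk⇔ ⇒ ⇐
  where
  open ReverseCons a w
  ⇒ : ModAscʳ (a ∷ w) → ∀ i → AscentTopAt (reverse (a ∷ w)) i ⇔ LeftmostAt (reverse (a ∷ w)) i
  ⇒ (modAsc-w , asc⇔∉) i with view i
  ... | ‵fromℕ         = ⇔.trans (AscentTopAt-reverse-last a w) (⇔.trans asc⇔∉ (⇔.sym LeftmostAt-last))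
  ... | ‵inj₁ {i = j} _ = ⇔.trans (AscentTopAt-inject₁ j)
                                  (⇔.trans (to (ModAscʳ⇔ w) modAsc-w j) (⇔.sym (LeftmostAt-inject₁ j)))
  ⇐ : (∀ i → AscentTopAt (reverse (a ∷ w)) i ⇔ LeftmostAt (reverse (a ∷ w)) i) → ModAscʳ (a ∷ w)
  ⇐ at⇔lm = from (ModAscʳ⇔ w) (λ j → ⇔.trans (⇔.sym (AscentTopAt-inject₁ j))
                                             (⇔.trans (at⇔lm (inject₁ j)) (LeftmostAt-inject₁ j))) ,
            ⇔.trans (⇔.sym (AscentTopAt-reverse-last a w)) (⇔.trans (at⇔lm (fromℕ _)) LeftmostAt-last)

Contains-p321⇒Has321 : ∀ {n} (z : Vec ℕ n) → Contains z p321 → Has321 z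
Contains-p321⇒Has321 z (f , increasing , iso) =
  f zero , f (suc zero) , f (suc (suc zero)) ,
  increasing zero (suc zero) (s≤s z≤n) , increasing (suc zero) (suc (suc zero)) (s≤s (s≤s z≤n)) ,
  from (proj₁ (iso (suc zero) zero)) (s≤s (s≤s (s≤s z≤n))) ,
  from (proj₁ (iso (suc (suc zero)) (suc zero))) (s≤s (s≤s z≤n))

Has321⇒Contains-p321 : ∀ {n} (z : Vec ℕ n) → Has321 z → Contains z p321
Has321⇒Contains-p321 {n} z (i , j , l , i<j , j<l , zⱼ<zᵢ , zₗ<zⱼ) = f , increasing , iso
  where
  f : Fin 3 → Fin n
  f zero             = i
  f (suc zero)       = j
  f (suc (suc zero)) = l
  increasing : ∀ s t → toℕ s < toℕ t → toℕ (f s) < toℕ (f t)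
  increasing zero             (suc zero)       _ = i<j
  increasing zero             (suc (suc zero)) _ = <-trans i<j j<l
  increasing (suc zero)       (suc (suc zero)) _ = j<l
  increasing zero             zero             ()
  increasing (suc zero)       zero             ()
  increasing (suc zero)       (suc zero)       (s≤s ())
  increasing (suc (suc zero)) zero             ()
  increasing (suc (suc zero)) (suc zero)       (s≤s ())
  increasing (suc (suc zero)) (suc (suc zero)) (s≤s (s≤s ()))
  ascending : ∀ {x y p q : ℕ} → x < y → p < q → ((x < y) ⇔ (p < q)) × ((x ≡ y) ⇔ (p ≡ q))
  ascending x<y p<q = mk⇔ (λ _ → p<q) (λ _ → x<y) ,
                      mk⇔ (λ x≡y → contradiction x≡y (<⇒≢ x<y)) (λ p≡q → contradiction p≡q (<⇒≢ p<q))
  descending : ∀ {x y p q : ℕ} → y < x → q < p → ((x < y) ⇔ (p < q)) × ((x ≡ y) ⇔ (p ≡ q))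
  descending y<x q<p =
    mk⇔ (λ x<y → contradiction x<y (<-asym y<x)) (λ p<q → contradiction p<q (<-asym q<p)) ,
    mk⇔ (λ x≡y → contradiction (sym x≡y) (<⇒≢ y<x)) (λ p≡q → contradiction (sym p≡q) (<⇒≢ q<p))
  diagonal : ∀ {x p : ℕ} → ((x < x) ⇔ (p < p)) × ((x ≡ x) ⇔ (p ≡ p))
  diagonal = mk⇔ (λ x<x → contradiction x<x (<-irrefl refl)) (λ p<p → contradiction p<p (<-irrefl refl)) ,
             mk⇔ (λ _ → refl) (λ _ → refl)
  iso : ∀ s t → ((lookup z (f s) < lookup z (f t)) ⇔ (lookup p321 s < lookup p321 t))
              × ((lookup z (f s) ≡ lookup z (f t)) ⇔ (lookup p321 s ≡ lookup p321 t))
  iso zero             zero             = diagonal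
  iso zero             (suc zero)       = descending zⱼ<zᵢ (s≤s (s≤s (s≤s z≤n)))
  iso zero             (suc (suc zero)) = descending (<-trans zₗ<zⱼ zⱼ<zᵢ) (s≤s (s≤s z≤n))
  iso (suc zero)       zero             = ascending zⱼ<zᵢ (s≤s (s≤s (s≤s z≤n)))
  iso (suc zero)       (suc zero)       = diagonal
  iso (suc zero)       (suc (suc zero)) = descending zₗ<zⱼ (s≤s (s≤s z≤n))
  iso (suc (suc zero)) zero             = ascending (<-trans zₗ<zⱼ zⱼ<zᵢ) (s≤s (s≤s z≤n))
  iso (suc (suc zero)) (suc zero)       = ascending zₗ<zⱼ (s≤s (s≤s z≤n))
  iso (suc (suc zero)) (suc (suc zero)) = diagonal

inversion⇒<threshold : ∀ {n c} (w : Vec ℕ n) → InversionAbove (reverse w) c → c < threshold w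
inversion⇒<threshold {c = c} (b ∷ w) inv with to (ReverseCons.InversionAbove-∷ b w c) inv
... | inj₁ inv′ = ≤-trans (inversion⇒<threshold w inv′) (threshold≤thresholdStep b (maxV w) (threshold w))
... | inj₂ ((i , b<uᵢ) , c<b) =
  ≤-trans c<b (≤-trans (m≤m⊔n b (threshold w)) (≤-reflexive (sym (thresholdStep-< (threshold w) b<max))))
  where
  b<max : b < maxV w
  b<max = <-≤-trans b<uᵢ (∈⇒≤maxV (lookup-reverse-∈ w i))

<threshold⇒inversion : ∀ {n c} (w : Vec ℕ n) → 1 ≤ c → c < threshold w → InversionAbove (reverse w) c
<threshold⇒inversion     []      1≤c c<1 = contradiction c<1 (≤⇒≯ 1≤c)
<threshold⇒inversion {c = c} (b ∷ w) 1≤c c<t with ≤-<-connex (maxV w) b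
... | inj₁ max≤b = from (ReverseCons.InversionAbove-∷ b w c)
  (inj₁ (<threshold⇒inversion w 1≤c (subst (c <_) (thresholdStep-≮ (threshold w) (≤⇒≯ max≤b)) c<t)))
... | inj₂ b<max with ⊔-sel b (threshold w)
...   | inj₂ b⊔t≡t = from (ReverseCons.InversionAbove-∷ b w c)
  (inj₁ (<threshold⇒inversion w 1≤c (subst (c <_) (trans (thresholdStep-< (threshold w) b<max) b⊔t≡t) c<t)))
...   | inj₁ b⊔t≡b with v , v∈w , b<v ← <maxV⇒∃ w b<max with i , uᵢ≡v ← ∈⇒lookup-reverse w v∈w =
  from (ReverseCons.InversionAbove-∷ b w c)
    (inj₂ ((i , subst (b <_) (sym uᵢ≡v) b<v) ,
           subst (c <_) (trans (thresholdStep-< (threshold w) b<max) b⊔t≡b) c<t))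

Avoid321ʳ⇒¬Has321 : ∀ {n} (w : Vec ℕ n) → Avoid321ʳ w → ¬ Has321 (reverse w)
Avoid321ʳ⇒¬Has321 (a ∷ w) (avoids-w , t≤a) has with to (ReverseCons.Has321-∷ a w) has
... | inj₁ has′ = Avoid321ʳ⇒¬Has321 w avoids-w has′
... | inj₂ inv  = <⇒≱ (inversion⇒<threshold w inv) t≤a

¬Has321⇒Avoid321ʳ : ∀ {n} (w : Vec ℕ n) → (∀ {v} → v ∈ w → 1 ≤ v) → ¬ Has321 (reverse w) → Avoid321ʳ w
¬Has321⇒Avoid321ʳ []      _        _    = tt
¬Has321⇒Avoid321ʳ (a ∷ w) positive ¬has =
  ¬Has321⇒Avoid321ʳ w (positive ∘ there) (¬has ∘ from (ReverseCons.Has321-∷ a w) ∘ inj₁) ,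
  ≮⇒≥ (λ a<t → ¬has (from (ReverseCons.Has321-∷ a w)
                             (inj₂ (<threshold⇒inversion w (positive (here refl)) a<t))))

Modasc321ʳ⇒reverse : ∀ {n} {w : Vec ℕ n} → Modasc321ʳ w → maxV w ≤ n →
                     IsModAsc (reverse w) × Avoids (reverse w) p321
Modasc321ʳ⇒reverse {w = w} V max≤n =
  ((maxV w , max≤n , λ v → mk⇔ (bounds ∘ to (∈-reverse w) ∘ to (∃-lookup⇔∈ (reverse w)))
                                (∈⇒lookup-reverse w ∘ λ (1≤v , v≤max) → gapless V 1≤v v≤max)) ,
   from (IsModAsc⇔ (reverse w) (positive V ∘ lookup-reverse-∈ w)) (to (ModAscʳ⇔ w) (modAsc V))) ,
  Avoid321ʳ⇒¬Has321 w (avoids V) ∘ Contains-p321⇒Has321 (reverse w)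
  where
  bounds : ∀ {v} → v ∈ w → 1 ≤ v × v ≤ maxV w
  bounds v∈w = positive V v∈w , ∈⇒≤maxV v∈w

reverse⇒Modasc321ʳ : ∀ {n} {w : Vec ℕ n} → IsModAsc (reverse w) × Avoids (reverse w) p321 → Modasc321ʳ w
reverse⇒Modasc321ʳ {w = w} (((k , _ , values) , tops⇔copies) , avoids321) =
  mkModasc321ʳ (from (ModAscʳ⇔ w) (to (IsModAsc⇔ (reverse w) (positive′ ∘ lookup-reverse-∈ w)) tops⇔copies))
               (¬Has321⇒Avoid321ʳ w positive′ (avoids321 ∘ Has321⇒Contains-p321 (reverse w)))
               positive′ gapless′
  where
  bounds : ∀ {v} → v ∈ w → 1 ≤ v × v ≤ k
  bounds v∈w = to (values _) (∈⇒lookup-reverse w v∈w)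
  positive′ : ∀ {v} → v ∈ w → 1 ≤ v
  positive′ = proj₁ ∘ bounds
  gapless′ : Gapless w
  gapless′ 1≤v v≤max with i , uᵢ≡v ← from (values _) (1≤v , ≤-trans v≤max (maxV-lub w (proj₂ ∘ bounds))) =
    subst (_∈ w) uᵢ≡v (lookup-reverse-∈ w i)

proposition5p5 : ∀ (n : ℕ) → 1 ≤ n →
    HasSize {n} (λ x → IsModAsc x × Avoids x p321) (catSum n)
proposition5p5 (suc d) _ =
  List.map reverse (level d) , map⁺ reverse-injective (level-unique d) , (λ z → mk⇔ sound (complete z)) , count
  where
  P : Vec ℕ (suc d) → Set
  P z = IsModAsc z × Avoids z p321
  sound : ∀ {z} → z ∈ₗ List.map reverse (level d) → P z
  sound z∈ with w , w∈ , refl ← List∈.∈-map⁻ reverse z∈ = uncurry Modasc321ʳ⇒reverse (level-sound d w∈)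
  complete : ∀ z → P z → z ∈ₗ List.map reverse (level d)
  complete z Pz = subst (_∈ₗ List.map reverse (level d)) (reverse-involutive z) (List∈.∈-map⁺ reverse
    (level-complete d (reverse⇒Modasc321ʳ {w = reverse z} (subst P (sym (reverse-involutive z)) Pz))))
  count : length (List.map reverse (level d)) ≡ catSum (suc d)
  count = begin
    length (List.map reverse (level d)) ≡⟨ length-map reverse (level d) ⟩
    length (level d)                    ≡⟨ length-level d ⟩
    iterate succession d (λ _ → 1) 0    ≡⟨ iterate-succession≡catSum d ⟩
    catSum (suc d)                      ∎
    where open ≡-Reasoning
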